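{- Let $(G_n)_{n\geq1}$ be a sequence of connected graphs, $G_n$ having $n$ vertices, and let $(\tau_n)_{n\geq1}$ be positive integers such that $\delta(G_n)/\tau_n\to\infty$ as $n\to\infty$. Then $\mathsf{c}^{\max}_{\tau_n}(G_n)/n\to0$ as $n\to\infty$.
   Context: $\delta(G)$ is the minimum degree of a simple graph $G$. A multi-layer graph with designated layers is $(V,\{C_1,\dots,C_\tau\},R)$ with cop layers $C_i\subseteq\binom V2$ and robber layer $R\subseteq\binom V2$; $(V,\{C_1,\dots,C_\tau\},*)$ means $R=C_1\cup\dots\cup C_\tau$. Game with allocation $(k_1,\dots,k_\tau)$: $k_i$ cops assigned to layer $C_i$; cops placed first, then the robber; turns alternate starting with the cops; each cop stays or moves along one edge of its own layer, the robber stays or moves along one edge of $R$; cops win if a cop ever occupies the robber's vertex. The multi-layer cop number $\mathsf c(\mathcal G)$ is the least $k$ such that some allocation with $\sum_ik_i=k$ gives the cop player a winning strategy. For a connected simple graph $G=(V,E)$ and integer $\tau\geq1$, $\mathcal{L}(G,\tau)$ is the set of all multi-layer graphs $(V,\{C_1,\dots,C_\tau\},*)$ with $C_1\cup\dots\cup C_\tau=E$ and each $(V,C_i)$ connected; $\mathsf{c}^{\max}_\tau(G)=\max_{\mathcal G\in\mathcal L(G,\tau)}\mathsf c(\mathcal G)$. -}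

module Defs where

open import Data.Nat using (ℕ; zero; suc; _+_; _*_; _≤_; _⊓_)
open import Data.Fin using (Fin; zero; suc)
open import Data.Bool using (Bool; true; false; if_then_else_)
open import Data.List using (List; []; _∷_; map; allFin)
open import Data.Nat.ListAction using (sum)
open import Data.Product using (Σ; ∃; ∃-syntax; _×_; _,_)
open import Data.Sum using (_⊎_)
open import Relation.Binary.PropositionalEquality using (_≡_)
open import Relation.Binary.Construct.Closure.ReflexiveTransitive using (Star)

record Graph (n : ℕ) : Set where
  field
    adj    : Fin n → Fin n → Bool
    sym    : ∀ u v → adj u v ≡ adj v u
    irrefl : ∀ v → adj v v ≡ false
open Graph public

EdgeRel : ∀ {n} → (Fin n → Fin n → Bool) → Fin n → Fin n → Set
EdgeRel E u v = E u v ≡ true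

ConnectedRel : ∀ {n} → (Fin n → Fin n → Bool) → Set
ConnectedRel {n} E = ∀ (u v : Fin n) → Star (EdgeRel E) u v

Connected : ∀ {n} → Graph n → Set
Connected G = ConnectedRel (adj G)

degree : ∀ {n} → Graph n → Fin n → ℕ
degree {n} G v = sum (map (λ u → if adj G v u then 1 else 0) (allFin n))

-- minimum of a list (0 for the empty list)
minList : List ℕ → ℕ
minList []           = 0
minList (x ∷ [])     = x
minList (x ∷ y ∷ ys) = x ⊓ minList (y ∷ ys)

δ : ∀ {n} → Graph n → ℕ
δ {n} G = minList (map (degree G) (allFin n))

sumFin : ∀ {τ} → (Fin τ → ℕ) → ℕ
sumFin {zero}  k = 0
sumFin {suc τ} k = k zero + sumFin (λ i → k (suc i))

-- Multi-layer cops and robber game.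
-- Cop layers C : Fin τ → edge sets, robber layer R, allocation k.

module Game {n τ : ℕ} (C : Fin τ → Fin n → Fin n → Bool)
            (R : Fin n → Fin n → Bool) (k : Fin τ → ℕ) where

  CopPos : Set
  CopPos = (i : Fin τ) → Fin (k i) → Fin n

  Captured : CopPos → Fin n → Set
  Captured c r = Σ (Fin τ) λ i → Σ (Fin (k i)) λ j → c i j ≡ r

  CopMove : CopPos → CopPos → Set
  CopMove c c' = ∀ i j → (c' i j ≡ c i j) ⊎ EdgeRel (C i) (c i j) (c' i j)

  RobMove : Fin n → Fin n → Set
  RobMove r r' = (r' ≡ r) ⊎ EdgeRel R r r'

  -- CopsWin c r : it is the cops' turn, cops at c, robber at r, and the
  -- cops can force a capture in finitely many rounds.
  data CopsWin : CopPos → Fin n → Set where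
    caught : ∀ {c r} → Captured c r → CopsWin c r
    move   : ∀ {c r} (c' : CopPos) → CopMove c c' →
             (Captured c' r ⊎ (∀ r' → RobMove r r' → CopsWin c' r')) →
             CopsWin c r

  -- cops are placed first, then the robber; then cops move first
  CopStrategyWins : Set
  CopStrategyWins = Σ CopPos λ c₀ → ∀ r₀ → CopsWin c₀ r₀

-- c(𝒢) ≤ m : some allocation with total at most m is winning for the cops
-- (c(𝒢) is the least total of a winning allocation).
CopNumberLE : ∀ {n τ} → (Fin τ → Fin n → Fin n → Bool) →
              (Fin n → Fin n → Bool) → ℕ → Set
CopNumberLE {τ = τ} C R m =
  Σ (Fin τ → ℕ) λ k → sumFin k ≤ m × Game.CopStrategyWins C R k

record Layering {n : ℕ} (G : Graph n) (τ : ℕ) : Set where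
  field
    layer     : Fin τ → Fin n → Fin n → Bool
    layer-sym : ∀ i u v → layer i u v ≡ layer i v u
    sub       : ∀ i u v → layer i u v ≡ true → adj G u v ≡ true
    cover     : ∀ u v → adj G u v ≡ true → ∃[ i ] (layer i u v ≡ true)
    conn      : ∀ i → ConnectedRel (layer i)
open Layering public

-- c^max_τ(G) ≤ m : every 𝒢 ∈ 𝓛(G,τ) has c(𝒢) ≤ m (robber layer R = E = ⋃ C_i)
CmaxLE : ∀ {n} → Graph n → ℕ → ℕ → Set
CmaxLE G τ m = (L : Layering G τ) → CopNumberLE (layer L) (adj G) m

-- Cops placed on a layered dominating set (every vertex is occupied, or adjacent to a cop
-- in that cop's layer) capture the robber on their first move, so it suffices to find
-- such a set with at most n/(K+1) cops. Build it greedily with threshold q = 2(K+1):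
-- while some vertex dominates, within one layer, at least q of the undominated vertices U,
-- put a cop of that layer on it. When this stops, double count the pairs (layer edge ur, r ∈ U):
-- each r ∈ U lies on at least δ(G) layer edges because the layers cover E, while each of the
-- τn pairs (layer, u) reaches fewer than q vertices of U. Hence |U| δ(G) ≤ τnq, which for
-- δ(G) ≥ q²τ means q|U| ≤ n, and U is covered by one cop per vertex. Since every greedy
-- cop dominates q new vertices, in total q · #cops ≤ n + n.

module Submission where

open import Defs hiding (sym)
open import Data.Nat.Base using (ℕ; zero; suc; _+_; _*_; _≤_; _≥_; _<_; z≤n; NonZero; >-nonZero; >-nonZero⁻¹)
open import Data.Nat.Properties hiding (_≟_)
open import Data.Nat.DivMod using (_/_; m/n*n≤m; m*n/n≡m; /-monoˡ-≤)
open import Data.Nat.Induction using (<-wellFounded)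
open import Data.Nat.Tactic.RingSolver using (solve-∀)
import Data.Nat.ListAction as ListAction
open import Algebra.Properties.Semiring.Sum +-*-semiring
  using (sum; sum-syntax; sum-cong-≗; sum-remove; sum-replicate-zero; ∑-comm; ∑-distrib-+; *-distribʳ-sum)
open import Data.Bool using (Bool; true; false; if_then_else_; _∧_; _∨_; not)
open import Data.Bool.Properties using (∨-zeroʳ; ∧-identityʳ)
open import Data.Empty using (⊥-elim)
open import Data.Fin using (Fin; zero; suc; fromℕ<; punchIn)
open import Data.Fin.Properties using (_≟_; any?; punchInᵢ≢i)
open import Data.List using (List; []; _∷_; length; tabulate; lookup)
open import Data.List.Properties using (map-tabulate)
open import Data.List.Membership.Propositional using (_∈_)
open import Data.List.Membership.Propositional.Properties using (∈-map⁺; ∈-allFin)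
open import Data.List.Relation.Unary.Any using (here; there; index)
open import Data.List.Relation.Unary.Any.Properties using (lookup-index)
open import Data.Product using (∃-syntax; _×_; _,_; proj₁; proj₂)
open import Data.Sum using (_⊎_; inj₁; inj₂)
open import Data.Vec.Functional using (updateAt)
open import Data.Vec.Functional.Properties using (updateAt-updates; updateAt-minimal)
open import Function using (_∘_; id)
open import Induction.WellFounded using (Acc; acc)
open import Relation.Nullary using (yes; no; does)
open import Relation.Nullary.Decidable using (dec-true)
open import Relation.Binary.PropositionalEquality

indicator : Bool → ℕ
indicator b = if b then 1 else 0

sumFin≡sum : ∀ {m} (f : Fin m → ℕ) → sumFin f ≡ sum f
sumFin≡sum {zero}  f = refl
sumFin≡sum {suc m} f = cong (f zero +_) (sumFin≡sum (f ∘ suc))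

sumList-tabulate : ∀ {m} (f : Fin m → ℕ) → ListAction.sum (tabulate f) ≡ sum f
sumList-tabulate {zero}  f = refl
sumList-tabulate {suc m} f = cong (f zero +_) (sumList-tabulate (f ∘ suc))

sum-mono-≤ : ∀ {m} {f g : Fin m → ℕ} → (∀ i → f i ≤ g i) → sum f ≤ sum g
sum-mono-≤ {zero}  f≤g = z≤n
sum-mono-≤ {suc m} f≤g = +-mono-≤ (f≤g zero) (sum-mono-≤ (f≤g ∘ suc))

sum-≤-* : ∀ {m b} {f : Fin m → ℕ} → (∀ i → f i ≤ b) → sum f ≤ m * b
sum-≤-* {zero}  f≤b = z≤n
sum-≤-* {suc m} f≤b = +-mono-≤ (f≤b zero) (sum-≤-* (f≤b ∘ suc))

term≤sum : ∀ {m} (f : Fin m → ℕ) i → f i ≤ sum f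
term≤sum f zero    = m≤m+n _ _
term≤sum f (suc i) = ≤-trans (term≤sum (f ∘ suc) i) (m≤n+m _ (f zero))

sum-ones : ∀ m → sum {m} (λ _ → 1) ≡ m
sum-ones zero    = refl
sum-ones (suc m) = cong suc (sum-ones m)

sum-updateAt-suc : ∀ {m} (f : Fin m → ℕ) i → sum (updateAt f i suc) ≡ suc (sum f)
sum-updateAt-suc {suc m} f i = begin
  sum (updateAt f i suc)                              ≡⟨ sum-remove {i = i} (updateAt f i suc) ⟩
  updateAt f i suc i + sum (updateAt f i suc ∘ punchIn i)
    ≡⟨ cong₂ _+_ (updateAt-updates i f)
                 (sum-cong-≗ λ j → updateAt-minimal (punchIn i j) i f (punchInᵢ≢i i j)) ⟩
  suc (f i + sum (f ∘ punchIn i))                     ≡⟨ cong suc (sum-remove {i = i} f) ⟨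
  suc (sum f)                                         ∎
  where open ≡-Reasoning

indicator-split : ∀ a b → indicator a ≡ indicator (a ∧ not b) + indicator (a ∧ b)
indicator-split false b     = refl
indicator-split true  false = refl
indicator-split true  true  = refl

indicator-∧-mono-∨ : ∀ a b c → indicator (a ∧ b) ≤ indicator (a ∧ (b ∨ c))
indicator-∧-mono-∨ false b     c = z≤n
indicator-∧-mono-∨ true  false c = z≤n
indicator-∧-mono-∨ true  true  c = ≤-refl

sparse-arithmetic : ∀ {q τ s n δ₀} .{{_ : NonZero q}} .{{_ : NonZero τ}} →
  q * q * τ ≤ δ₀ → s * δ₀ ≤ τ * (n * q) → q * s ≤ n
sparse-arithmetic {q} {τ} {s} {n} {δ₀} qqτ≤δ₀ sδ₀≤ =
  *-cancelʳ-≤ (q * s) n (q * τ) {{m*n≢0 q τ}} (begin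
  q * s * (q * τ) ≡⟨ lhs q τ s ⟩
  s * (q * q * τ) ≤⟨ *-monoʳ-≤ s qqτ≤δ₀ ⟩
  s * δ₀          ≤⟨ sδ₀≤ ⟩
  τ * (n * q)     ≡⟨ rhs q τ n ⟩
  n * (q * τ)     ∎)
  where
  open ≤-Reasoning
  lhs : ∀ q τ s → q * s * (q * τ) ≡ s * (q * q * τ)
  lhs = solve-∀
  rhs : ∀ q τ n → τ * (n * q) ≡ n * (q * τ)
  rhs = solve-∀

*≤⇒≤/ : ∀ d {t n} .{{_ : NonZero d}} → d * t ≤ n → t ≤ n / d
*≤⇒≤/ d {t} {n} dt≤n =
  subst (_≤ n / d) (m*n/n≡m t d) (/-monoˡ-≤ d (subst (_≤ n) (*-comm d t) dt≤n))

*[/suc]≤ : ∀ m n → m * (n / suc m) ≤ n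
*[/suc]≤ m n = ≤-trans (*-monoˡ-≤ (n / suc m) (n≤1+n m))
                       (subst (_≤ n) (*-comm (n / suc m) (suc m)) (m/n*n≤m n (suc m)))

halve-≤ : ∀ a t n → 2 * a * t ≤ n + n → a * t ≤ n
halve-≤ a t n 2at≤2n = *-cancelˡ-≤ 2 (subst₂ _≤_ (*-assoc 2 a t) (doubling n) 2at≤2n)
  where
  doubling : ∀ n → n + n ≡ 2 * n
  doubling = solve-∀

module _ {n : ℕ} where

  size : (Fin n → Bool) → ℕ
  size U = ∑[ r < n ] indicator (U r)

  _∖_ _∩_ : (Fin n → Bool) → (Fin n → Bool) → (Fin n → Bool)
  (U ∖ X) r = U r ∧ not (X r)
  (U ∩ X) r = U r ∧ X r

  size-split : ∀ U X → size U ≡ size (U ∖ X) + size (U ∩ X)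
  size-split U X = trans (sum-cong-≗ λ r → indicator-split (U r) (X r))
                         (∑-distrib-+ (indicator ∘ (U ∖ X)) (indicator ∘ (U ∩ X)))

  size-∖-< : ∀ U X → 1 ≤ size (U ∩ X) → size (U ∖ X) < size U
  size-∖-< U X 1≤U∩X = subst (size (U ∖ X) <_) (sym (size-split U X)) (m<m+n _ 1≤U∩X)

  size-≥1 : ∀ {U} r → U r ≡ true → 1 ≤ size U
  size-≥1 {U} r r∈U = subst (λ b → indicator b ≤ size U) r∈U (term≤sum (indicator ∘ U) r)

-- S i lists the positions of the cops assigned to layer i.
Placement : ℕ → ℕ → Set
Placement τ n = Fin τ → List (Fin n)

total : ∀ {τ n} → Placement τ n → ℕ
total S = sum (length ∘ S)

place : ∀ {τ n} → Placement τ n → Fin τ → Fin n → Placement τ n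
place S i u = updateAt S i (u ∷_)

total-place : ∀ {τ n} (S : Placement τ n) i u → total (place S i u) ≡ suc (total S)
total-place S i u = trans (sum-cong-≗ length-place) (sum-updateAt-suc (length ∘ S) i)
  where
  length-place : ∀ j → length (place S i u j) ≡ updateAt (length ∘ S) i suc j
  length-place j with j ≟ i
  ... | yes refl = trans (cong length (updateAt-updates i S)) (sym (updateAt-updates i (length ∘ S)))
  ... | no j≢i   = trans (cong length (updateAt-minimal j i S j≢i))
                         (sym (updateAt-minimal j i (length ∘ S) j≢i))

∈-place-self : ∀ {τ n} (S : Placement τ n) i u → u ∈ place S i u i
∈-place-self S i u = subst (u ∈_) (sym (updateAt-updates i S)) (here refl)

∈-place : ∀ {τ n} (S : Placement τ n) i u {j x} → x ∈ S j → x ∈ place S i u j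
∈-place S i u {j} x∈ with j ≟ i
... | yes refl = subst (_ ∈_) (sym (updateAt-updates i S)) (there x∈)
... | no j≢i   = subst (_ ∈_) (sym (updateAt-minimal j i S j≢i)) x∈

module Domination {n τ : ℕ} (C : Fin τ → Fin n → Fin n → Bool) where

  Dominates : Fin τ → Fin n → Fin n → Set
  Dominates i u r = u ≡ r ⊎ C i u r ≡ true

  closedNbhd : Fin τ → Fin n → Fin n → Bool
  closedNbhd i u r = C i u r ∨ does (u ≟ r)

  closedNbhd-self : ∀ i u → closedNbhd i u u ≡ true
  closedNbhd-self i u = trans (cong (C i u u ∨_) (dec-true (u ≟ u) refl)) (∨-zeroʳ _)

  closedNbhd⇒dominates : ∀ {i u r} → closedNbhd i u r ≡ true → Dominates i u r
  closedNbhd⇒dominates {i} {u} {r} h with C i u r | u ≟ r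
  ... | true  | _       = inj₂ refl
  ... | false | yes u≡r = inj₁ u≡r
  closedNbhd⇒dominates () | false | no _

  DominatesOn : Placement τ n → (Fin n → Bool) → Set
  DominatesOn S U = ∀ r → U r ≡ true → ∃[ i ] ∃[ u ] (u ∈ S i × Dominates i u r)

  Dominating : Placement τ n → Set
  Dominating S = DominatesOn S (λ _ → true)

  dominatesOn-place : ∀ {S U} i u → DominatesOn S (U ∖ closedNbhd i u) →
    DominatesOn (place S i u) U
  dominatesOn-place {S} {U} i u dom r r∈U with closedNbhd i u r in e
  ... | true  = i , u , ∈-place-self S i u , closedNbhd⇒dominates e
  ... | false with dom r (trans (cong (λ b → U r ∧ not b) e) (trans (∧-identityʳ (U r)) r∈U))
  ... | j , v , v∈ , d = j , v , ∈-place S i u v∈ , d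

  coverage : Fin τ → Fin n → (Fin n → Bool) → ℕ
  coverage i u U = size (U ∩ closedNbhd i u)

  Sparse : ℕ → (Fin n → Bool) → Set
  Sparse q U = ∀ i u → coverage i u U < q

  greedy-domination : ∀ q → 1 ≤ q → ∀ D →
    (∀ U → Sparse q U → ∃[ S ] (DominatesOn S U × q * total S ≤ D)) →
    ∀ U → ∃[ S ] (DominatesOn S U × q * total S ≤ size U + D)
  greedy-domination q 1≤q D sparse U = go U (<-wellFounded (size U))
    where
    place-bound : ∀ {U i u} S → q ≤ coverage i u U →
      q * total S ≤ size (U ∖ closedNbhd i u) + D → q * total (place S i u) ≤ size U + D
    place-bound {U} {i} {u} S q≤c qS≤ = begin
      q * total (place S i u)             ≡⟨ cong (q *_) (total-place S i u) ⟩
      q * suc (total S)                   ≡⟨ *-suc q (total S) ⟩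
      q + q * total S                     ≤⟨ +-mono-≤ q≤c qS≤ ⟩
      coverage i u U + (size (U ∖ X) + D) ≡⟨ +-assoc (coverage i u U) _ D ⟨
      coverage i u U + size (U ∖ X) + D  ≡⟨ cong (_+ D) (+-comm (coverage i u U) _) ⟩
      size (U ∖ X) + coverage i u U + D   ≡⟨ cong (_+ D) (size-split U X) ⟨
      size U + D                          ∎
      where
      open ≤-Reasoning
      X = closedNbhd i u

    go : ∀ U → Acc _<_ (size U) → ∃[ S ] (DominatesOn S U × q * total S ≤ size U + D)
    go U (acc smaller) with any? (λ i → any? (λ u → q ≤? coverage i u U))
    ... | no none with sparse U (λ i u → ≰⇒> λ q≤c → none (i , u , q≤c))
    ...   | S , dom , qS≤D = S , dom , ≤-trans qS≤D (m≤n+m D (size U))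
    go U (acc smaller) | yes (i , u , q≤c)
      with go (U ∖ closedNbhd i u) (smaller (size-∖-< U (closedNbhd i u) (≤-trans 1≤q q≤c)))
    ... | S , dom , qS≤ = place S i u , dominatesOn-place i u dom , place-bound S q≤c qS≤

  pointwise-domination : Fin τ → ∀ U → ∃[ S ] (DominatesOn S U × total S ≤ size U)
  pointwise-domination i₀ U =
    let S , dom , 1*S≤U+0 = greedy-domination 1 ≤-refl 0 nothing-sparse U
    in S , dom , subst₂ _≤_ (*-identityˡ (total S)) (+-identityʳ (size U)) 1*S≤U+0
    where
    nothing-sparse : ∀ U → Sparse 1 U → ∃[ S ] (DominatesOn S U × 1 * total S ≤ 0)
    nothing-sparse U sparse =
      (λ _ → []) , (λ r r∈U → ⊥-elim (<⇒≱ (sparse i₀ r) (self-covered r r∈U))) ,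
      ≤-reflexive (trans (*-identityˡ _) (sum-replicate-zero τ))
      where
      self-covered : ∀ r → U r ≡ true → 1 ≤ coverage i₀ r U
      self-covered r r∈U = size-≥1 {U = U ∩ closedNbhd i₀ r} r
        (trans (cong (_∧ closedNbhd i₀ r r) r∈U) (closedNbhd-self i₀ r))

  layerDegree : Fin n → ℕ
  layerDegree r = ∑[ i < τ ] ∑[ u < n ] indicator (C i u r)

  sparse-size : ∀ {q δ₀} U → Sparse q U → (∀ r → δ₀ ≤ layerDegree r) →
    size U * δ₀ ≤ τ * (n * q)
  sparse-size {q} {δ₀} U sparse δ₀≤deg = begin
    size U * δ₀                                  ≡⟨ *-distribʳ-sum δ₀ (indicator ∘ U) ⟩
    ∑[ r < n ] (indicator (U r) * δ₀)            ≤⟨ sum-mono-≤ weigh ⟩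
    ∑[ r < n ] ∑[ i < τ ] ∑[ u < n ] incident r i u  ≡⟨ ∑-comm (λ r i → ∑[ u < n ] incident r i u) ⟩
    ∑[ i < τ ] ∑[ r < n ] ∑[ u < n ] incident r i u  ≡⟨ sum-cong-≗ (λ i → ∑-comm (λ r → incident r i)) ⟩
    ∑[ i < τ ] ∑[ u < n ] ∑[ r < n ] incident r i u  ≤⟨ sum-mono-≤ (λ i → sum-mono-≤ (λ u → sum-mono-≤ (λ r →
                                                      indicator-∧-mono-∨ (U r) (C i u r) _))) ⟩
    ∑[ i < τ ] ∑[ u < n ] coverage i u U         ≤⟨ sum-≤-* (λ i → sum-≤-* (λ u → <⇒≤ (sparse i u))) ⟩
    τ * (n * q)                                  ∎
    where
    open ≤-Reasoning
    incident : Fin n → Fin τ → Fin n → ℕ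
    incident r i u = indicator (U r ∧ C i u r)

    weigh : ∀ r → indicator (U r) * δ₀ ≤ ∑[ i < τ ] ∑[ u < n ] incident r i u
    weigh r with U r
    ... | false = z≤n
    ... | true  = ≤-trans (≤-reflexive (*-identityˡ δ₀)) (δ₀≤deg r)

  small-domination : ∀ q δ₀ .{{_ : NonZero q}} → 1 ≤ τ → q * q * τ ≤ δ₀ →
    (∀ r → δ₀ ≤ layerDegree r) → ∃[ S ] (Dominating S × q * total S ≤ n + n)
  small-domination q δ₀ 1≤τ qqτ≤δ₀ δ₀≤deg =
    let S , dom , qS≤ = greedy-domination q (>-nonZero⁻¹ q) n leftover (λ _ → true)
    in S , dom , subst (λ s → q * total S ≤ s + n) (sum-ones n) qS≤
    where
    instance
      τ≢0 : NonZero τ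
      τ≢0 = >-nonZero 1≤τ

    leftover : ∀ U → Sparse q U → ∃[ S ] (DominatesOn S U × q * total S ≤ n)
    leftover U sparse =
      let S , dom , S≤U = pointwise-domination (fromℕ< 1≤τ) U
      in S , dom , ≤-trans (*-monoʳ-≤ q S≤U) (sparse-arithmetic qqτ≤δ₀ (sparse-size U sparse δ₀≤deg))

  dominating⇒copsWin : ∀ R (S : Placement τ n) → Dominating S →
    Game.CopStrategyWins C R (length ∘ S)
  dominating⇒copsWin R S dom = start , λ r → respond r (dom r refl)
    where
    open Game C R (length ∘ S)

    start : CopPos
    start i j = lookup (S i) j

    chase : Fin n → CopPos
    chase r i j = if C i (start i j) r then r else start i j

    chase-legal : ∀ r → CopMove start (chase r)
    chase-legal r i j with C i (start i j) r in e
    ... | true  = inj₂ e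
    ... | false = inj₁ refl

    step-onto : ∀ {i x r} → C i x r ≡ true → (if C i x r then r else x) ≡ r
    step-onto e rewrite e = refl

    respond : ∀ r → ∃[ i ] ∃[ u ] (u ∈ S i × Dominates i u r) → CopsWin start r
    respond r (i , u , u∈ , inj₁ u≡r) = caught (i , index u∈ , trans (sym (lookup-index u∈)) u≡r)
    respond r (i , u , u∈ , inj₂ ur∈C) = move (chase r) (chase-legal r)
      (inj₁ (i , index u∈ , step-onto (subst (λ x → C i x r ≡ true) (lookup-index u∈) ur∈C)))

minList-≤ : ∀ {x xs} → x ∈ xs → minList xs ≤ x
minList-≤ {xs = _ ∷ []}     (here refl)  = ≤-refl
minList-≤ {xs = x ∷ _ ∷ _}  (here refl)  = m⊓n≤m x _
minList-≤ {xs = x ∷ y ∷ ys} (there x∈) = ≤-trans (m⊓n≤n x _) (minList-≤ x∈)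

δ≤degree : ∀ {n} (G : Graph n) r → δ G ≤ degree G r
δ≤degree G r = minList-≤ (∈-map⁺ (degree G) (∈-allFin r))

degree≡sum : ∀ {n} (G : Graph n) r → degree G r ≡ ∑[ u < n ] indicator (adj G r u)
degree≡sum G r = trans (cong ListAction.sum (map-tabulate id (indicator ∘ adj G r)))
                       (sumList-tabulate (indicator ∘ adj G r))

δ≤layerDegree : ∀ {n τ} {G : Graph n} (L : Layering G τ) r →
  δ G ≤ Domination.layerDegree (layer L) r
δ≤layerDegree {n} {τ} {G} L r = begin
  δ G                                             ≤⟨ δ≤degree G r ⟩
  degree G r                                      ≡⟨ degree≡sum G r ⟩
  ∑[ u < n ] indicator (adj G r u)                ≤⟨ sum-mono-≤ edge≤layers ⟩
  ∑[ u < n ] ∑[ i < τ ] indicator (layer L i u r) ≡⟨ ∑-comm (λ u i → indicator (layer L i u r)) ⟩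
  Domination.layerDegree (layer L) r              ∎
  where
  open ≤-Reasoning
  edge≤layers : ∀ u → indicator (adj G r u) ≤ ∑[ i < τ ] indicator (layer L i u r)
  edge≤layers u with adj G r u in e
  ... | false = z≤n
  ... | true with cover L r u e
  ... | i , ru∈i = subst (λ b → indicator b ≤ ∑[ i < τ ] indicator (layer L i u r))
                         (trans (layer-sym L i u r) ru∈i)
                         (term≤sum (λ i → indicator (layer L i u r)) i)

proposition6p3 : (G : (n : ℕ) → Graph n) → (∀ n → Connected (G n)) →
    (τ : ℕ → ℕ) → (∀ n → 1 ≤ τ n) →
    (∀ M → ∃[ N ] (∀ n → n ≥ N → M * τ n ≤ δ (G n))) →
    ∀ K → ∃[ N ] (∀ n → n ≥ N → ∃[ m ] (K * m ≤ n × CmaxLE (G n) (τ n) m))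
proposition6p3 G _ τ τ≥1 δ≫τ K = N , λ n n≥N → n / suc K , *[/suc]≤ K n , cmax n n≥N
  where
  q = 2 * suc K
  N = proj₁ (δ≫τ (q * q))

  cmax : ∀ n → n ≥ N → CmaxLE (G n) (τ n) (n / suc K)
  cmax n n≥N L
    with Domination.small-domination (layer L) q (δ (G n)) (τ≥1 n)
           (proj₂ (δ≫τ (q * q)) n n≥N) (δ≤layerDegree L)
  ... | S , dom , qS≤2n =
    length ∘ S ,
    subst (_≤ n / suc K) (sym (sumFin≡sum (length ∘ S)))
          (*≤⇒≤/ (suc K) (halve-≤ (suc K) (total S) n qS≤2n)) ,
    Domination.dominating⇒copsWin (layer L) (adj (G n)) S dom
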